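{- Let $d\geq3$, let $F$ be a locally sparse $d$-regular graph on $[n]$, let $k\in\mathbb{N}$ and let $F':=F[[k]]$ be the subgraph of $F$ induced on $[k]$. For every $3\leq v\leq n-3$, the number of closed subgraphs of $F$ with $v$ vertices that are contained in $F'$ is at most $\frac{2dk}{3}$.
   Context: For $\tilde F\subset F$, a vertex of $\tilde F$ is boundary if its degree in $\tilde F$ is less than $d$; the edge boundary $\partial_e(\tilde F)$ is the set of edges of $F$ between boundary vertices of $\tilde F$ and $V(F)\setminus V(\tilde F)$. $F$ is locally sparse if every subgraph $\tilde F\subset F$ with $3\leq|V(\tilde F)|\leq n-3$ has $|\partial_e(\tilde F)|\geq d+1$. Let $\Delta=d+1$ if $d$ is odd and $\Delta=d+2$ if $d$ is even. A closed subgraph of $F$ is an induced subgraph of $F$ whose edge boundary has size exactly $\Delta$. -}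

module Defs where

open import Data.Bool using (Bool; true; false; _∧_; _∨_; not; if_then_else_)
open import Data.Nat using (ℕ; zero; suc; _+_; _*_; _∸_; _≤_; _<ᵇ_; _≡ᵇ_)
open import Data.Fin using (Fin; toℕ)
open import Data.Fin.Subset using (Subset; ∣_∣)
open import Data.List using (List; []; _∷_; length; filterᵇ; map; _++_; allFin)
open import Data.Nat.ListAction using (sum)
open import Data.Bool.ListAction using () renaming (and to andᵇ)
open import Data.Vec using (lookup)
import Data.Vec as Vec
open import Data.Product using (_×_; _,_)
open import Relation.Binary.PropositionalEquality using (_≡_; refl)

-- A finite simple graph on the vertex set [n] = Fin n (vertex i+1 ↔ Fin index i),
-- given by a symmetric irreflexive Boolean adjacency relation.
record Graph (n : ℕ) : Set where
  field
    adj    : Fin n → Fin n → Bool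
    sym    : ∀ x y → adj x y ≡ adj y x
    irrefl : ∀ x → adj x x ≡ false
open Graph public

countᵇ : ∀ {n} → (Fin n → Bool) → ℕ
countᵇ {n} f = length (filterᵇ f (allFin n))

degree : ∀ {n} → Graph n → Fin n → ℕ
degree G x = countᵇ (adj G x)

Regular : ∀ {n} → ℕ → Graph n → Set
Regular d G = ∀ x → degree G x ≡ d

record Subgraph {n : ℕ} (G : Graph n) : Set where
  field
    verts     : Subset n
    edges     : Fin n → Fin n → Bool
    edges-sym : ∀ x y → edges x y ≡ edges y x
    edges-⊆   : ∀ x y → edges x y ≡ true →
                (adj G x y ≡ true) × (lookup verts x ≡ true) × (lookup verts y ≡ true)
open Subgraph public

subDegree : ∀ {n} {G : Graph n} → Subgraph G → Fin n → ℕ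
subDegree H x = countᵇ (edges H x)

isBoundary : ∀ {n} {G : Graph n} → ℕ → Subgraph G → Fin n → Bool
isBoundary d H x = lookup (verts H) x ∧ (subDegree H x <ᵇ d)

-- |∂_e(H)|: number of edges of G between a boundary vertex of H and a vertex
-- outside V(H) (each such edge counted once, from its endpoint in V(H)).
edgeBoundarySize : ∀ {n} (d : ℕ) (G : Graph n) → Subgraph G → ℕ
edgeBoundarySize {n} d G H =
  sum (map (λ x → countᵇ (λ y → isBoundary d H x ∧ adj G x y ∧ not (lookup (verts H) y)))
           (allFin n))

LocallySparse : ∀ {n} → ℕ → Graph n → Set
LocallySparse {n} d G = (H : Subgraph G) → 3 ≤ ∣ verts H ∣ → ∣ verts H ∣ ≤ n ∸ 3 →
                        suc d ≤ edgeBoundarySize d G H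

private
  ind-sym : ∀ (a b c c' : Bool) → c ≡ c' → (a ∧ b ∧ c) ≡ (b ∧ a ∧ c')
  ind-sym true  true  c .c refl = refl
  ind-sym true  false c .c refl = refl
  ind-sym false true  c .c refl = refl
  ind-sym false false c .c refl = refl

  ind-⊆ : ∀ (a b c : Bool) → (a ∧ b ∧ c) ≡ true → (c ≡ true) × (a ≡ true) × (b ≡ true)
  ind-⊆ true true true refl = refl , refl , refl

induced : ∀ {n} (G : Graph n) → Subset n → Subgraph G
induced G S = record
  { verts     = S
  ; edges     = λ x y → lookup S x ∧ lookup S y ∧ adj G x y
  ; edges-sym = λ x y → ind-sym (lookup S x) (lookup S y) (adj G x y) (adj G y x) (sym G x y)
  ; edges-⊆   = λ x y e → ind-⊆ (lookup S x) (lookup S y) (adj G x y) e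
  }

isEven : ℕ → Bool
isEven zero = true
isEven (suc m) = not (isEven m)

Δ : ℕ → ℕ
Δ d = if isEven d then d + 2 else d + 1

isClosed : ∀ {n} → ℕ → Graph n → Subset n → Bool
isClosed d G S = edgeBoundarySize d G (induced G S) ≡ᵇ Δ d

inPrefix : ∀ {n} → ℕ → Subset n → Bool
inPrefix {n} k S = andᵇ (map (λ x → not (lookup S x) ∨ (toℕ x <ᵇ k)) (allFin n))

allSubsets : (n : ℕ) → List (Subset n)
allSubsets zero = Vec.[] ∷ []
allSubsets (suc n) = map (true Vec.∷_) (allSubsets n) ++ map (false Vec.∷_) (allSubsets n)

-- number of closed subgraphs of G with v vertices contained in G[[k]]
-- (closed subgraphs are induced, hence determined by their vertex sets)
closedCount : ∀ {n} → ℕ → Graph n → ℕ → ℕ → ℕ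
closedCount {n} d G k v =
  length (filterᵇ (λ S → isClosed d G S ∧ inPrefix k S ∧ (∣ S ∣ ≡ᵇ v)) (allSubsets n))

{-# OPTIONS --safe #-}
module Submission where

-- Write cut f for the number of edges leaving a vertex set f. A vertex with a neighbour outside f
-- has degree < d in F[f], so |∂_e(F[f])| = cut f and the closed sets are those with cut f = Δ.
-- Local sparsity, the handshake identity cut f + 2e(f) = d|f| and parity give cut f ≥ Δ for
-- 2 ≤ |f| ≤ n - 3. Posimodularity,
--   cut f + cut g = cut (f ∖ g) + cut (g ∖ f) + 2 e(f ∩ g, V ∖ (f ∪ g)),
-- then forces two distinct closed sets of the same size with a common boundary edge x → y to
-- differ by one vertex each, with at most Δ - d edges from f ∩ g to V ∖ (f ∪ g). Three such sets
-- would form a sunflower (or their complements would), and these bounds summed over the three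
-- pairs contradict cut ≥ Δ for the common core. So every edge u → w with u ∈ [k] leaves at most
-- two of the counted closed sets, and double counting gives Δ N ≤ 2dk, hence 3N ≤ 2dk.

open import Defs hiding (sym)

open import Data.Bool using (Bool; true; false; _∧_; _∨_; not; T; T?)
open import Data.Bool.Properties using (∧-comm; not-involutive; not-injective; T-≡; T-not-≡; T-∧)
open import Data.Empty using (⊥; ⊥-elim)
open import Data.Fin using (Fin; zero; suc; toℕ)
open import Data.Fin.Subset using (Subset; ∣_∣)
open import Data.List using (List; []; _∷_; length; map; filterᵇ; tabulate; allFin)
open import Data.List.Membership.Propositional using (_∈_)
open import Data.List.Membership.Propositional.Properties using (∈-map⁻; ∈-allFin)
open import Data.List.Properties using (map-tabulate; filter-none)
open import Data.List.Relation.Unary.All as All using (All; []; _∷_)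
open import Data.List.Relation.Unary.All.Properties using (all⁺; all-filter; filter⁺)
open import Data.List.Relation.Unary.AllPairs using ([]; _∷_)
open import Data.List.Relation.Unary.Unique.Propositional using (Unique)
import Data.List.Relation.Unary.Unique.Propositional.Properties as Unique
open import Data.Nat
  using (ℕ; zero; suc; pred; _+_; _*_; _∸_; _≤_; _<_; _<ᵇ_; _≡ᵇ_; z≤n; s≤s; s≤s⁻¹)
open import Data.Nat.Divisibility
  using (_∣_; divides; _∣0; ∣-refl; ∣m∣n⇒∣m+n; ∣m+n∣m⇒∣n; m∣m*n; ∣m⇒∣m*n; ∣1⇒≡1)
open import Data.Nat.ListAction using (sum)
open import Data.Nat.Properties
open import Algebra.Properties.Semiring.Sum +-*-semiring
  using (sum-syntax; ∑-distrib-+; ∑-comm; *-distribˡ-sum; *-distribʳ-sum; sum-cong-≗;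
         sum-replicate-zero)
  renaming (sum to ∑)
open import Data.Nat.Solver using (module +-*-Solver)
open import Data.Product using (_×_; _,_; proj₁; proj₂)
open import Data.Sum using (_⊎_; inj₁; inj₂; [_,_]′)
open import Data.Vec using (lookup)
open import Data.Vec.Properties using (lookup∘tabulate; tabulate∘lookup; tabulate-cong; ∷-injectiveʳ)
import Data.Vec as Vec
open import Function using (_∘_; Equivalence)
open import Relation.Binary.PropositionalEquality
  using (_≡_; _≗_; refl; sym; trans; cong; cong₂; subst; subst₂; module ≡-Reasoning)
open import Relation.Nullary using (¬_; contradiction)

open +-*-Solver using (solve; _:+_; _:*_; _:=_; con)

[_] : Bool → ℕ
[ true ] = 1
[ false ] = 0

[b]≡0⇒b≡false : ∀ {b} → [ b ] ≡ 0 → b ≡ false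
[b]≡0⇒b≡false {false} _ = refl

∑-mono-≤ : ∀ {n} {f g : Fin n → ℕ} → (∀ i → f i ≤ g i) → ∑ f ≤ ∑ g
∑-mono-≤ {zero} f≤g = z≤n
∑-mono-≤ {suc n} f≤g = +-mono-≤ (f≤g zero) (∑-mono-≤ (f≤g ∘ suc))

∑-mono-< : ∀ {n} {f g : Fin n → ℕ} → (∀ i → f i ≤ g i) → ∀ j → f j < g j → ∑ f < ∑ g
∑-mono-< f≤g zero fj<gj = +-mono-<-≤ fj<gj (∑-mono-≤ (f≤g ∘ suc))
∑-mono-< f≤g (suc j) fj<gj = +-mono-≤-< (f≤g zero) (∑-mono-< (f≤g ∘ suc) j fj<gj)

term≤∑ : ∀ {n} (f : Fin n → ℕ) i → f i ≤ ∑ f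
term≤∑ f zero = m≤m+n _ _
term≤∑ f (suc i) = ≤-trans (term≤∑ (f ∘ suc) i) (m≤n+m _ _)

∑≡0⇒≡0 : ∀ {n} (f : Fin n → ℕ) → ∑ f ≡ 0 → ∀ i → f i ≡ 0
∑≡0⇒≡0 f ∑f≡0 zero = m+n≡0⇒m≡0 (f zero) ∑f≡0
∑≡0⇒≡0 f ∑f≡0 (suc i) = ∑≡0⇒≡0 (f ∘ suc) (m+n≡0⇒n≡0 (f zero) ∑f≡0) i

∑-one : ∀ n → ∑[ i < n ] 1 ≡ n
∑-one zero = refl
∑-one (suc n) = cong suc (∑-one n)

∑-distrib-+₃ : ∀ {n} (f g h : Fin n → ℕ) → ∑[ i < n ] (f i + g i + h i) ≡ ∑ f + ∑ g + ∑ h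
∑-distrib-+₃ f g h = trans (∑-distrib-+ (λ i → f i + g i) h) (cong (_+ ∑ h) (∑-distrib-+ f g))

∑∑-symmetric-even : ∀ {m} (g : Fin m → Fin m → ℕ) → (∀ i j → g i j ≡ g j i) → (∀ i → g i i ≡ 0) →
                    2 ∣ ∑[ i < m ] ∑[ j < m ] g i j
∑∑-symmetric-even {zero} g _ _ = 2 ∣0
∑∑-symmetric-even {suc m} g g-sym g-diag =
  subst (2 ∣_) (sym split) (∣m∣n⇒∣m+n (m∣m*n X) rest-even)
  where
  open ≡-Reasoning
  X = ∑[ j < m ] g zero (suc j)
  R = ∑[ i < m ] ∑[ j < m ] g (suc i) (suc j)
  rest-even : 2 ∣ R
  rest-even = ∑∑-symmetric-even (λ i j → g (suc i) (suc j)) (λ i j → g-sym (suc i) (suc j)) (g-diag ∘ suc)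
  split : ∑[ i < suc m ] ∑[ j < suc m ] g i j ≡ 2 * X + R
  split = begin
    g zero zero + X + ∑[ i < m ] (g (suc i) zero + ∑[ j < m ] g (suc i) (suc j))
      ≡⟨ cong₂ (λ a b → a + X + b) (g-diag zero)
               (∑-distrib-+ (λ i → g (suc i) zero) (λ i → ∑[ j < m ] g (suc i) (suc j))) ⟩
    X + (∑[ i < m ] g (suc i) zero + R)
      ≡⟨ cong (λ a → X + (a + R)) (sum-cong-≗ (λ i → g-sym (suc i) zero)) ⟩
    X + (X + R)
      ≡⟨ solve 2 (λ X R → X :+ (X :+ R) := con 2 :* X :+ R) refl X R ⟩
    2 * X + R ∎

VertexSet : ℕ → Set
VertexSet n = Fin n → Bool

module _ {n : ℕ} where

  infixr 7 _∩_
  infixr 6 _∪_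
  infix 8 _∖_

  ∁ : VertexSet n → VertexSet n
  ∁ f u = not (f u)

  _∩_ _∪_ _∖_ : VertexSet n → VertexSet n → VertexSet n
  (f ∩ g) u = f u ∧ g u
  (f ∪ g) u = f u ∨ g u
  (f ∖ g) u = f u ∧ not (g u)

  card : VertexSet n → ℕ
  card f = ∑[ u < n ] [ f u ]

  card-cong : ∀ {f g} → f ≗ g → card f ≡ card g
  card-cong f≗g = sum-cong-≗ (cong [_] ∘ f≗g)

  card-∩-∖ : ∀ f g → card f ≡ card (f ∩ g) + card (f ∖ g)
  card-∩-∖ f g = trans (sum-cong-≗ (λ u → split (f u) (g u))) (∑-distrib-+ (λ u → [ f u ∧ g u ]) _)
    where
    split : ∀ a b → [ a ] ≡ [ a ∧ b ] + [ a ∧ not b ]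
    split true true = refl
    split true false = refl
    split false b = refl

  card-∁ : ∀ f → card (∁ f) + card f ≡ n
  card-∁ f = trans (sym (∑-distrib-+ (λ u → [ not (f u) ]) _)) (trans (sum-cong-≗ (λ u → split (f u))) (∑-one n))
    where
    split : ∀ a → [ not a ] + [ a ] ≡ 1
    split true = refl
    split false = refl

  card-∖-comm : ∀ {f g} → card f ≡ card g → card (f ∖ g) ≡ card (g ∖ f)
  card-∖-comm {f} {g} |f|≡|g| = +-cancelˡ-≡ (card (f ∩ g)) _ _ (begin
    card (f ∩ g) + card (f ∖ g) ≡⟨ sym (card-∩-∖ f g) ⟩
    card f                      ≡⟨ |f|≡|g| ⟩
    card g                      ≡⟨ card-∩-∖ g f ⟩
    card (g ∩ f) + card (g ∖ f) ≡⟨ cong (_+ card (g ∖ f)) (card-cong (λ u → ∧-comm (g u) (f u))) ⟩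
    card (f ∩ g) + card (g ∖ f) ∎)
    where open ≡-Reasoning

  ∖-empty⇒≗ : ∀ {f g} → card (f ∖ g) ≡ 0 → card (g ∖ f) ≡ 0 → f ≗ g
  ∖-empty⇒≗ {f} {g} f∖g≡0 g∖f≡0 u = both-empty (f u) (g u) (∑≡0⇒≡0 _ f∖g≡0 u) (∑≡0⇒≡0 _ g∖f≡0 u)
    where
    both-empty : ∀ a b → [ a ∧ not b ] ≡ 0 → [ b ∧ not a ] ≡ 0 → a ≡ b
    both-empty true true _ _ = refl
    both-empty false false _ _ = refl

exactlyTwo : Bool → Bool → Bool → Bool
exactlyTwo a b c = (a ∧ b ∧ not c) ∨ (a ∧ not b ∧ c) ∨ (not a ∧ b ∧ c)

∧-absorbs-third : ∀ a b c → exactlyTwo a b c ≡ false → a ∧ b ∧ c ≡ a ∧ b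
∧-absorbs-third false b c _ = refl
∧-absorbs-third true false c _ = refl
∧-absorbs-third true true true _ = refl

venn-differences : ∀ a b c →
  ([ a ∧ not b ] + [ b ∧ not a ]) + ([ a ∧ not c ] + [ c ∧ not a ]) + ([ b ∧ not c ] + [ c ∧ not b ]) ≡
  2 * ([ exactlyTwo (not a) (not b) (not c) ] + [ exactlyTwo a b c ])
venn-differences true true true = refl
venn-differences true true false = refl
venn-differences true false true = refl
venn-differences true false false = refl
venn-differences false true true = refl
venn-differences false true false = refl
venn-differences false false true = refl
venn-differences false false false = refl

venn-sizes : ∀ a b c →
  [ a ] + [ b ] + [ c ] ≡
  ([ exactlyTwo (not a) (not b) (not c) ] + [ exactlyTwo a b c ]) + [ exactlyTwo a b c ] + 3 * [ a ∧ b ∧ c ]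
venn-sizes true true true = refl
venn-sizes true true false = refl
venn-sizes true false true = refl
venn-sizes true false false = refl
venn-sizes false true true = refl
venn-sizes false true false = refl
venn-sizes false false true = refl
venn-sizes false false false = refl

sunflower-indicators : ∀ a₁ a₂ a₃ b₁ b₂ b₃ → exactlyTwo b₁ b₂ b₃ ≡ false →
  [ (a₁ ∧ a₂ ∧ a₃) ∧ not (b₁ ∧ b₂ ∧ b₃) ] + 2 * [ (a₁ ∧ a₂ ∧ a₃) ∧ not (b₁ ∨ b₂ ∨ b₃) ] ≤
  [ (a₁ ∧ a₂) ∧ not (b₁ ∨ b₂) ] + [ (a₁ ∧ a₃) ∧ not (b₁ ∨ b₃) ] + [ (a₂ ∧ a₃) ∧ not (b₂ ∨ b₃) ]
sunflower-indicators false a₂ a₃ b₁ b₂ b₃ _ = z≤n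
sunflower-indicators true false a₃ b₁ b₂ b₃ _ = z≤n
sunflower-indicators true true false b₁ b₂ b₃ _ = z≤n
sunflower-indicators true true true true true true _ = ≤-refl
sunflower-indicators true true true true false false _ = ≤-refl
sunflower-indicators true true true false true false _ = ≤-refl
sunflower-indicators true true true false false true _ = ≤-refl
sunflower-indicators true true true false false false _ = ≤-refl

module _ {n : ℕ} where

  inExactlyTwo inExactlyOne : VertexSet n → VertexSet n → VertexSet n → VertexSet n
  inExactlyTwo f₁ f₂ f₃ u = exactlyTwo (f₁ u) (f₂ u) (f₃ u)
  inExactlyOne f₁ f₂ f₃ = inExactlyTwo (∁ f₁) (∁ f₂) (∁ f₃)

  multiple-of-3-≤3 : ∀ {m} → 3 ∣ m → m ≤ 3 → m ≡ 0 ⊎ m ≡ 3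
  multiple-of-3-≤3 (divides zero refl) _ = inj₁ refl
  multiple-of-3-≤3 (divides (suc zero) refl) _ = inj₂ refl
  multiple-of-3-≤3 (divides (suc (suc q)) refl) (s≤s (s≤s (s≤s ())))

  -- If Nⱼ vertices lie in exactly j of the sets, then N₁ + N₂ = 3 and 3 ∣ N₂.
  venn-dichotomy : ∀ {v} (f₁ f₂ f₃ : VertexSet n) → card f₁ ≡ v → card f₂ ≡ v → card f₃ ≡ v →
    card (f₁ ∖ f₂) + card (f₂ ∖ f₁) ≡ 2 → card (f₁ ∖ f₃) + card (f₃ ∖ f₁) ≡ 2 →
    card (f₂ ∖ f₃) + card (f₃ ∖ f₂) ≡ 2 →
    card (inExactlyTwo f₁ f₂ f₃) ≡ 0 ⊎ card (inExactlyOne f₁ f₂ f₃) ≡ 0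
  venn-dichotomy {v} f₁ f₂ f₃ |f₁| |f₂| |f₃| δ₁₂ δ₁₃ δ₂₃ =
    [ inj₁ , (λ N₂≡3 → inj₂ (+-cancelʳ-≡ N₂ N₁ 0 (trans N₁+N₂≡3 (sym N₂≡3)))) ]′
    (multiple-of-3-≤3 3∣N₂ (m+n≤o⇒n≤o N₁ (≤-reflexive N₁+N₂≡3)))
    where
    open ≡-Reasoning
    one two all : Fin n → ℕ
    one u = [ inExactlyOne f₁ f₂ f₃ u ]
    two u = [ inExactlyTwo f₁ f₂ f₃ u ]
    all u = [ (f₁ ∩ f₂ ∩ f₃) u ]
    N₁ = ∑ one
    N₂ = ∑ two
    δ : VertexSet n → VertexSet n → Fin n → ℕ
    δ f g u = [ f u ∧ not (g u) ] + [ g u ∧ not (f u) ]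
    ∑δ : ∀ f g → ∑ (δ f g) ≡ card (f ∖ g) + card (g ∖ f)
    ∑δ f g = ∑-distrib-+ (λ u → [ f u ∧ not (g u) ]) _
    N₁+N₂≡3 : N₁ + N₂ ≡ 3
    N₁+N₂≡3 = *-cancelˡ-≡ _ _ 2 (begin
      2 * (N₁ + N₂)                             ≡⟨ cong (2 *_) (sym (∑-distrib-+ one two)) ⟩
      2 * ∑[ u < n ] (one u + two u)            ≡⟨ *-distribˡ-sum 2 (λ u → one u + two u) ⟩
      ∑[ u < n ] (2 * (one u + two u))          ≡⟨ sum-cong-≗ (λ u → sym (venn-differences (f₁ u) (f₂ u) (f₃ u))) ⟩
      ∑[ u < n ] (δ f₁ f₂ u + δ f₁ f₃ u + δ f₂ f₃ u)
                                                ≡⟨ ∑-distrib-+₃ (δ f₁ f₂) (δ f₁ f₃) (δ f₂ f₃) ⟩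
      ∑ (δ f₁ f₂) + ∑ (δ f₁ f₃) + ∑ (δ f₂ f₃)   ≡⟨ cong₂ _+_ (cong₂ _+_ (trans (∑δ f₁ f₂) δ₁₂) (trans (∑δ f₁ f₃) δ₁₃))
                                                             (trans (∑δ f₂ f₃) δ₂₃) ⟩
      2 * 3                                     ∎)
    3v≡ : 3 * (1 + ∑ all) + N₂ ≡ 3 * v
    3v≡ = begin
      3 * (1 + ∑ all) + N₂                      ≡⟨ solve 2 (λ a b → con 3 :* (con 1 :+ a) :+ b := con 3 :+ b :+ con 3 :* a) refl (∑ all) N₂ ⟩
      3 + N₂ + 3 * ∑ all                        ≡⟨ cong (λ s → s + N₂ + 3 * ∑ all) (sym N₁+N₂≡3) ⟩
      N₁ + N₂ + N₂ + 3 * ∑ all                  ≡⟨ cong₂ (λ s t → s + N₂ + t) (sym (∑-distrib-+ one two)) (*-distribˡ-sum 3 all) ⟩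
      ∑[ u < n ] (one u + two u) + N₂ + ∑[ u < n ] (3 * all u)
                                                ≡⟨ sym (∑-distrib-+₃ (λ u → one u + two u) two (λ u → 3 * all u)) ⟩
      ∑[ u < n ] (one u + two u + two u + 3 * all u)
                                                ≡⟨ sum-cong-≗ (λ u → sym (venn-sizes (f₁ u) (f₂ u) (f₃ u))) ⟩
      ∑[ u < n ] ([ f₁ u ] + [ f₂ u ] + [ f₃ u ]) ≡⟨ ∑-distrib-+₃ (λ u → [ f₁ u ]) (λ u → [ f₂ u ]) (λ u → [ f₃ u ]) ⟩
      card f₁ + card f₂ + card f₃               ≡⟨ cong₂ _+_ (cong₂ _+_ |f₁| |f₂|) |f₃| ⟩
      v + v + v                                 ≡⟨ solve 1 (λ v → v :+ v :+ v := con 3 :* v) refl v ⟩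
      3 * v                                     ∎
    3∣N₂ : 3 ∣ N₂
    3∣N₂ = ∣m+n∣m⇒∣n (subst (3 ∣_) (sym 3v≡) (m∣m*n v)) (m∣m*n (1 + ∑ all))

2∣⇒∤suc : ∀ {m} → 2 ∣ m → ¬ 2 ∣ suc m
2∣⇒∤suc {m} 2∣m 2∣1+m with ∣1⇒≡1 (∣m+n∣m⇒∣n (subst (2 ∣_) (+-comm 1 m) 2∣1+m) 2∣m)
... | ()

isEven⇒2∣ : ∀ d → isEven d ≡ true → 2 ∣ d
isEven⇒2∣ zero _ = 2 ∣0
isEven⇒2∣ (suc (suc d)) even = ∣m∣n⇒∣m+n ∣-refl (isEven⇒2∣ d (trans (sym (not-involutive (isEven d))) even))

Δ-cases : ∀ d → Δ d ≡ suc d ⊎ (2 ∣ d × Δ d ≡ 2 + d)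
Δ-cases d with isEven d in even
... | true = inj₂ (isEven⇒2∣ d even , +-comm d 2)
... | false = inj₁ (+-comm d 1)

d<Δ : ∀ d → d < Δ d
d<Δ d = [ (λ Δ≡ → ≤-reflexive (sym Δ≡))
         , (λ (_ , Δ≡) → ≤-trans (n≤1+n _) (≤-reflexive (sym Δ≡)))
         ]′ (Δ-cases d)

Δ≤2+d : ∀ d → Δ d ≤ 2 + d
Δ≤2+d d = [ (λ Δ≡ → ≤-trans (≤-reflexive Δ≡) (n≤1+n _)) , (λ (_ , Δ≡) → ≤-reflexive Δ≡) ]′ (Δ-cases d)

Δ+2≤d+d : ∀ {d} → 3 ≤ d → Δ d + 2 ≤ d + d
Δ+2≤d+d {d} 3≤d with Δ-cases d
... | inj₁ Δ≡ = subst (_≤ d + d) (sym (trans (cong (_+ 2) Δ≡) (+-comm (suc d) 2))) (+-monoˡ-≤ d 3≤d)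
... | inj₂ (2∣d , Δ≡) = subst (_≤ d + d) (sym (trans (cong (_+ 2) Δ≡) (+-comm (2 + d) 2))) (+-monoˡ-≤ d 4≤d)
  where
  4≤d : 4 ≤ d
  4≤d = ≤∧≢⇒< 3≤d (λ 3≡d → 2∣⇒∤suc ∣-refl (subst (2 ∣_) (sym 3≡d) 2∣d))

Δ+Δ<d+d+d+2 : ∀ {d} → 3 ≤ d → Δ d + Δ d < d + d + d + 2
Δ+Δ<d+d+d+2 {d} 3≤d = begin-strict
  Δ d + Δ d        ≤⟨ +-mono-≤ (Δ≤2+d d) (Δ≤2+d d) ⟩
  2 + d + (2 + d)  ≡⟨ solve 1 (λ d → con 2 :+ d :+ (con 2 :+ d) := d :+ d :+ con 4) refl d ⟩
  d + d + 4        <⟨ +-monoʳ-< (d + d) (+-monoˡ-< 2 3≤d) ⟩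
  d + d + (d + 2)  ≡⟨ solve 1 (λ d → d :+ d :+ (d :+ con 2) := d :+ d :+ d :+ con 2) refl d ⟩
  d + d + d + 2    ∎
  where open ≤-Reasoning

posimodular-indicators : ∀ s t s′ t′ →
  ([ s ∧ not s′ ] + [ s′ ∧ not s ]) + ([ t ∧ not t′ ] + [ t′ ∧ not t ]) ≡
  ([ (s ∧ not t) ∧ not (s′ ∧ not t′) ] + [ (s′ ∧ not t′) ∧ not (s ∧ not t) ]) +
  ([ (t ∧ not s) ∧ not (t′ ∧ not s′) ] + [ (t′ ∧ not s′) ∧ not (t ∧ not s) ]) +
  2 * ([ (s ∧ t) ∧ not (s′ ∨ t′) ] + [ (s′ ∧ t′) ∧ not (s ∨ t) ])
posimodular-indicators true true true true = refl
posimodular-indicators true true true false = refl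
posimodular-indicators true true false true = refl
posimodular-indicators true true false false = refl
posimodular-indicators true false true true = refl
posimodular-indicators true false true false = refl
posimodular-indicators true false false true = refl
posimodular-indicators true false false false = refl
posimodular-indicators false true true true = refl
posimodular-indicators false true true false = refl
posimodular-indicators false true false true = refl
posimodular-indicators false true false false = refl
posimodular-indicators false false true true = refl
posimodular-indicators false false true false = refl
posimodular-indicators false false false true = refl
posimodular-indicators false false false false = refl

module Cuts {n : ℕ} (G : Graph n) where

  edgeSum : (Fin n → Fin n → ℕ) → ℕ
  edgeSum φ = ∑[ u < n ] ∑[ w < n ] ([ adj G u w ] * φ u w)

  e[_,_] : VertexSet n → VertexSet n → ℕ
  e[ A , B ] = edgeSum (λ u w → [ A u ∧ B w ])

  cut : VertexSet n → ℕ
  cut f = e[ f , ∁ f ]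

  edgeSum-cong : ∀ {φ ψ} → (∀ u w → φ u w ≡ ψ u w) → edgeSum φ ≡ edgeSum ψ
  edgeSum-cong φ≡ψ = sum-cong-≗ (λ u → sum-cong-≗ (λ w → cong ([ adj G u w ] *_) (φ≡ψ u w)))

  edgeSum-+ : ∀ φ ψ → edgeSum (λ u w → φ u w + ψ u w) ≡ edgeSum φ + edgeSum ψ
  edgeSum-+ φ ψ = trans
    (sum-cong-≗ (λ u → trans (sum-cong-≗ (λ w → *-distribˡ-+ [ adj G u w ] (φ u w) (ψ u w)))
                             (∑-distrib-+ (λ w → [ adj G u w ] * φ u w) _)))
    (∑-distrib-+ (λ u → ∑[ w < n ] ([ adj G u w ] * φ u w)) _)

  edgeSum-+₃ : ∀ φ ψ χ → edgeSum (λ u w → φ u w + ψ u w + χ u w) ≡ edgeSum φ + edgeSum ψ + edgeSum χ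
  edgeSum-+₃ φ ψ χ = trans (edgeSum-+ (λ u w → φ u w + ψ u w) χ) (cong (_+ edgeSum χ) (edgeSum-+ φ ψ))

  edgeSum-*ˡ : ∀ c φ → edgeSum (λ u w → c * φ u w) ≡ c * edgeSum φ
  edgeSum-*ˡ c φ = trans
    (sum-cong-≗ (λ u → trans (sum-cong-≗ (λ w → x*[y*z]≡y*[x*z] [ adj G u w ] c (φ u w)))
                             (sym (*-distribˡ-sum c (λ w → [ adj G u w ] * φ u w)))))
    (sym (*-distribˡ-sum c (λ u → ∑[ w < n ] ([ adj G u w ] * φ u w))))
    where
    x*[y*z]≡y*[x*z] : ∀ x y z → x * (y * z) ≡ y * (x * z)
    x*[y*z]≡y*[x*z] = solve 3 (λ x y z → x :* (y :* z) := y :* (x :* z)) refl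

  edgeSum-zero : edgeSum (λ _ _ → 0) ≡ 0
  edgeSum-zero = trans (sum-cong-≗ (λ u → trans (sum-cong-≗ (λ w → *-zeroʳ [ adj G u w ])) (sum-replicate-zero n)))
                       (sum-replicate-zero n)

  sum-map-edgeSum : ∀ {A : Set} (φ : A → Fin n → Fin n → ℕ) xs →
                    sum (map (λ x → edgeSum (φ x)) xs) ≡ edgeSum (λ u w → sum (map (λ x → φ x u w) xs))
  sum-map-edgeSum φ [] = sym edgeSum-zero
  sum-map-edgeSum φ (x ∷ xs) = trans (cong (edgeSum (φ x) +_) (sum-map-edgeSum φ xs)) (sym (edgeSum-+ (φ x) _))

  edgeSum-mono : ∀ {φ ψ} → (∀ u w → adj G u w ≡ true → φ u w ≤ ψ u w) → edgeSum φ ≤ edgeSum ψ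
  edgeSum-mono {φ} {ψ} φ≤ψ = ∑-mono-≤ (λ u → ∑-mono-≤ (λ w → on-edge u w (adj G u w) refl))
    where
    on-edge : ∀ u w b → adj G u w ≡ b → [ b ] * φ u w ≤ [ b ] * ψ u w
    on-edge u w true uw = *-monoʳ-≤ 1 (φ≤ψ u w uw)
    on-edge u w false _ = z≤n

  edgeSum-transpose : ∀ φ → edgeSum (λ u w → φ w u) ≡ edgeSum φ
  edgeSum-transpose φ = trans (∑-comm (λ u w → [ adj G u w ] * φ w u))
    (sum-cong-≗ (λ w → sum-cong-≗ (λ u → cong (λ b → [ b ] * φ w u) (Graph.sym G u w))))

  edgeSum-symmetrise : ∀ φ → edgeSum φ + edgeSum φ ≡ edgeSum (λ u w → φ u w + φ w u)
  edgeSum-symmetrise φ = trans (cong (edgeSum φ +_) (sym (edgeSum-transpose φ))) (sym (edgeSum-+ φ _))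

  edgeTerm≤edgeSum : ∀ φ u w → [ adj G u w ] * φ u w ≤ edgeSum φ
  edgeTerm≤edgeSum φ u w = ≤-trans (term≤∑ (λ w′ → [ adj G u w′ ] * φ u w′) w)
                                   (term≤∑ (λ u′ → ∑[ w′ < n ] ([ adj G u′ w′ ] * φ u′ w′)) u)

  edge⇒1≤e : ∀ {A B x y} → adj G x y ≡ true → A x ≡ true → B y ≡ true → 1 ≤ e[ A , B ]
  edge⇒1≤e {A} {B} {x} {y} xy Ax By =
    subst (_≤ e[ A , B ]) (cong₂ (λ a b → [ a ] * [ b ]) xy (cong₂ _∧_ Ax By))
          (edgeTerm≤edgeSum (λ u w → [ A u ∧ B w ]) x y)

  e-comm : ∀ A B → e[ A , B ] ≡ e[ B , A ]
  e-comm A B = trans (edgeSum-cong (λ u w → cong [_] (∧-comm (A u) (B w))))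
                     (edgeSum-transpose (λ u w → [ B u ∧ A w ]))

  cut-cong : ∀ {f g} → f ≗ g → cut f ≡ cut g
  cut-cong f≗g = edgeSum-cong (λ u w → cong₂ (λ a b → [ a ∧ not b ]) (f≗g u) (f≗g w))

  cut-∁ : ∀ f → cut (∁ f) ≡ cut f
  cut-∁ f = trans (edgeSum-cong (λ u w → cong (λ b → [ not (f u) ∧ b ]) (not-involutive (f w))))
                  (e-comm (∁ f) f)

  e[f,f]-even : ∀ f → 2 ∣ e[ f , f ]
  e[f,f]-even f = ∑∑-symmetric-even (λ u w → [ adj G u w ] * [ f u ∧ f w ])
    (λ u w → cong₂ _*_ (cong [_] (Graph.sym G u w)) (cong [_] (∧-comm (f u) (f w))))
    (λ u → cong (λ b → [ b ] * [ f u ∧ f u ]) (irrefl G u))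

  e[f,f]≤|f|*pred|f| : ∀ f → e[ f , f ] ≤ card f * pred (card f)
  e[f,f]≤|f|*pred|f| f = begin
    e[ f , f ]                         ≤⟨ ∑-mono-≤ row≤ ⟩
    ∑[ u < n ] ([ f u ] * pred (card f)) ≡⟨ sym (*-distribʳ-sum (pred (card f)) (λ u → [ f u ])) ⟩
    card f * pred (card f)             ∎
    where
    open ≤-Reasoning
    -- No loops, so u is not counted among its own neighbours in f.
    row≤ : ∀ u → ∑[ w < n ] ([ adj G u w ] * [ f u ∧ f w ]) ≤ [ f u ] * pred (card f)
    row≤ u with f u in fu
    ... | false = ≤-reflexive (trans (sum-cong-≗ (λ w → *-zeroʳ [ adj G u w ])) (sum-replicate-zero n))
    ... | true = ≤-trans (<⇒≤pred (∑-mono-< adj≤1 u uu<fu)) (≤-reflexive (sym (+-identityʳ _)))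
      where
      adj≤1 : ∀ w → [ adj G u w ] * [ f w ] ≤ [ f w ]
      adj≤1 w with adj G u w
      ... | true = ≤-reflexive (+-identityʳ _)
      ... | false = z≤n
      uu<fu : [ adj G u u ] * [ f u ] < [ f u ]
      uu<fu rewrite irrefl G u | fu = s≤s z≤n

  cut-posimodular : ∀ f g → cut f + cut g ≡ cut (f ∖ g) + cut (g ∖ f) + 2 * e[ f ∩ g , ∁ (f ∪ g) ]
  cut-posimodular f g = *-cancelˡ-≡ _ _ 2 (begin
    2 * (cut f + cut g)
      ≡⟨ solve 2 (λ a b → con 2 :* (a :+ b) := (a :+ a) :+ (b :+ b)) refl (cut f) (cut g) ⟩
    (cut f + cut f) + (cut g + cut g)
      ≡⟨ cong₂ _+_ (edgeSum-symmetrise (cutφ f)) (edgeSum-symmetrise (cutφ g)) ⟩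
    edgeSum (sym₂ (cutφ f)) + edgeSum (sym₂ (cutφ g))
      ≡⟨ sym (edgeSum-+ (sym₂ (cutφ f)) _) ⟩
    edgeSum (λ u w → sym₂ (cutφ f) u w + sym₂ (cutφ g) u w)
      ≡⟨ edgeSum-cong (λ u w → posimodular-indicators (f u) (g u) (f w) (g w)) ⟩
    edgeSum (λ u w → sym₂ (cutφ (f ∖ g)) u w + sym₂ (cutφ (g ∖ f)) u w + 2 * sym₂ χφ u w)
      ≡⟨ edgeSum-+₃ (sym₂ (cutφ (f ∖ g))) (sym₂ (cutφ (g ∖ f))) _ ⟩
    edgeSum (sym₂ (cutφ (f ∖ g))) + edgeSum (sym₂ (cutφ (g ∖ f))) + edgeSum (λ u w → 2 * sym₂ χφ u w)
      ≡⟨ cong₂ (λ a b → a + b + edgeSum (λ u w → 2 * sym₂ χφ u w))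
               (sym (edgeSum-symmetrise (cutφ (f ∖ g)))) (sym (edgeSum-symmetrise (cutφ (g ∖ f)))) ⟩
    (c₁ + c₁) + (c₂ + c₂) + edgeSum (λ u w → 2 * sym₂ χφ u w)
      ≡⟨ cong ((c₁ + c₁) + (c₂ + c₂) +_)
              (trans (edgeSum-*ˡ 2 (sym₂ χφ)) (cong (2 *_) (sym (edgeSum-symmetrise χφ)))) ⟩
    (c₁ + c₁) + (c₂ + c₂) + 2 * (χ + χ)
      ≡⟨ solve 3 (λ a b x → (a :+ a) :+ (b :+ b) :+ con 2 :* (x :+ x) := con 2 :* (a :+ b :+ con 2 :* x)) refl c₁ c₂ χ ⟩
    2 * (c₁ + c₂ + 2 * χ) ∎)
    where
    open ≡-Reasoning
    cutφ : VertexSet n → Fin n → Fin n → ℕ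
    cutφ h u w = [ h u ∧ not (h w) ]
    χφ : Fin n → Fin n → ℕ
    χφ u w = [ (f u ∧ g u) ∧ not (f w ∨ g w) ]
    sym₂ : (Fin n → Fin n → ℕ) → Fin n → Fin n → ℕ
    sym₂ φ u w = φ u w + φ w u
    c₁ = cut (f ∖ g)
    c₂ = cut (g ∖ f)
    χ = e[ f ∩ g , ∁ (f ∪ g) ]

  sunflower-crossings : ∀ f₁ f₂ f₃ → (∀ w → inExactlyTwo f₁ f₂ f₃ w ≡ false) →
    cut (f₁ ∩ f₂ ∩ f₃) + 2 * e[ f₁ ∩ f₂ ∩ f₃ , ∁ (f₁ ∪ f₂ ∪ f₃) ] ≤
    e[ f₁ ∩ f₂ , ∁ (f₁ ∪ f₂) ] + e[ f₁ ∩ f₃ , ∁ (f₁ ∪ f₃) ] + e[ f₂ ∩ f₃ , ∁ (f₂ ∪ f₃) ]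
  sunflower-crossings f₁ f₂ f₃ not-two = begin
    cut A + 2 * e[ A , ∁ B ]
      ≡⟨ sym (trans (edgeSum-+ (λ u w → [ A u ∧ not (A w) ]) _)
                    (cong (cut A +_) (edgeSum-*ˡ 2 (λ u w → [ A u ∧ not (B w) ])))) ⟩
    edgeSum (λ u w → [ A u ∧ not (A w) ] + 2 * [ A u ∧ not (B w) ])
      ≤⟨ edgeSum-mono (λ u w _ → sunflower-indicators (f₁ u) (f₂ u) (f₃ u) (f₁ w) (f₂ w) (f₃ w) (not-two w)) ⟩
    edgeSum (λ u w → [ (f₁ u ∧ f₂ u) ∧ not (f₁ w ∨ f₂ w) ] + [ (f₁ u ∧ f₃ u) ∧ not (f₁ w ∨ f₃ w) ]
                     + [ (f₂ u ∧ f₃ u) ∧ not (f₂ w ∨ f₃ w) ])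
      ≡⟨ edgeSum-+₃ _ _ _ ⟩
    e[ f₁ ∩ f₂ , ∁ (f₁ ∪ f₂) ] + e[ f₁ ∩ f₃ , ∁ (f₁ ∪ f₃) ] + e[ f₂ ∩ f₃ , ∁ (f₂ ∪ f₃) ] ∎
    where
    open ≤-Reasoning
    A = f₁ ∩ f₂ ∩ f₃
    B = f₁ ∪ f₂ ∪ f₃

length-filterᵇ : ∀ {A : Set} (p : A → Bool) xs → length (filterᵇ p xs) ≡ sum (map (λ x → [ p x ]) xs)
length-filterᵇ p [] = refl
length-filterᵇ p (x ∷ xs) with p x
... | true = cong suc (length-filterᵇ p xs)
... | false = length-filterᵇ p xs

sum-tabulate : ∀ {n} (f : Fin n → ℕ) → sum (tabulate f) ≡ ∑ f
sum-tabulate {zero} f = refl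
sum-tabulate {suc n} f = cong (f zero +_) (sum-tabulate (f ∘ suc))

sum-map-allFin : ∀ {n} (f : Fin n → ℕ) → sum (map f (allFin n)) ≡ ∑ f
sum-map-allFin f = trans (cong sum (map-tabulate (λ i → i) f)) (sum-tabulate f)

countᵇ≡card : ∀ {n} (p : Fin n → Bool) → countᵇ p ≡ card p
countᵇ≡card p = trans (length-filterᵇ p (allFin _)) (sum-map-allFin (λ u → [ p u ]))

∣S∣≡card : ∀ {n} (S : Subset n) → ∣ S ∣ ≡ card (lookup S)
∣S∣≡card Vec.[] = refl
∣S∣≡card (true Vec.∷ S) = cong suc (∣S∣≡card S)
∣S∣≡card (false Vec.∷ S) = ∣S∣≡card S

boundary-indicator : ∀ s b a t → (s ≡ true → a ≡ true → t ≡ false → b ≡ true) →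
                     [ (s ∧ b) ∧ a ∧ not t ] ≡ [ a ] * [ s ∧ not t ]
boundary-indicator false b a t _ = sym (*-zeroʳ [ a ])
boundary-indicator true true true t _ = sym (+-identityʳ [ not t ])
boundary-indicator true true false t _ = refl
boundary-indicator true false true true _ = refl
boundary-indicator true false true false h = contradiction (h refl refl refl) λ ()
boundary-indicator true false false t _ = refl

module DegreeCuts {n d : ℕ} (G : Graph n) (regular : Regular d G) where

  open Cuts G

  card-adj : ∀ u → card (adj G u) ≡ d
  card-adj u = trans (sym (countᵇ≡card (adj G u))) (regular u)

  edgeSum-source : ∀ (h : Fin n → ℕ) → edgeSum (λ u w → h u) ≡ d * ∑ h
  edgeSum-source h = trans (sum-cong-≗ row) (sym (*-distribˡ-sum d h))
    where
    row : ∀ u → ∑[ w < n ] ([ adj G u w ] * h u) ≡ d * h u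
    row u = trans (sym (*-distribʳ-sum (h u) (λ w → [ adj G u w ]))) (cong (_* h u) (card-adj u))

  handshake : ∀ f → cut f + e[ f , f ] ≡ d * card f
  handshake f = trans (sym (edgeSum-+ (λ u w → [ f u ∧ not (f w) ]) (λ u w → [ f u ∧ f w ])))
                      (trans (edgeSum-cong (λ u w → split (f u) (f w))) (edgeSum-source (λ u → [ f u ])))
    where
    split : ∀ a b → [ a ∧ not b ] + [ a ∧ b ] ≡ [ a ]
    split true true = refl
    split true false = refl
    split false b = refl

  d*card≤cut : ∀ f → d * card f ≤ cut f + card f * pred (card f)
  d*card≤cut f = ≤-trans (≤-reflexive (sym (handshake f))) (+-monoʳ-≤ (cut f) (e[f,f]≤|f|*pred|f| f))

  card≡1⇒d≤cut : ∀ {f} → card f ≡ 1 → d ≤ cut f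
  card≡1⇒d≤cut {f} |f|≡1 = subst₂ _≤_ (*-identityʳ d) (+-identityʳ (cut f))
    (subst (λ m → d * m ≤ cut f + m * pred m) |f|≡1 (d*card≤cut f))

  card≡2⇒d+d≤cut+2 : ∀ {f} → card f ≡ 2 → d + d ≤ cut f + 2
  card≡2⇒d+d≤cut+2 {f} |f|≡2 = subst (_≤ cut f + 2) (trans (*-comm d 2) (cong (d +_) (+-identityʳ d)))
    (subst (λ m → d * m ≤ cut f + m * pred m) |f|≡2 (d*card≤cut f))

  cut-even : ∀ {f} → 2 ∣ d → 2 ∣ cut f
  cut-even {f} 2∣d = ∣m+n∣m⇒∣n (subst (2 ∣_) (trans (sym (handshake f)) (+-comm (cut f) _)) (∣m⇒∣m*n (card f) 2∣d))
                               (e[f,f]-even f)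

  d<cut⇒Δ≤cut : ∀ {f} → d < cut f → Δ d ≤ cut f
  d<cut⇒Δ≤cut {f} d<cut with Δ-cases d
  ... | inj₁ Δ≡ = subst (_≤ cut f) (sym Δ≡) d<cut
  ... | inj₂ (2∣d , Δ≡) = subst (_≤ cut f) (sym Δ≡)
          (≤∧≢⇒< d<cut (λ 1+d≡cut → 2∣⇒∤suc 2∣d (subst (2 ∣_) (sym 1+d≡cut) (cut-even {f} 2∣d))))

  subDegree<d : ∀ (S : Subset n) {x y} → lookup S x ≡ true → adj G x y ≡ true → lookup S y ≡ false →
                subDegree (induced G S) x < d
  subDegree<d S {x} {y} Sx xy Sy =
    subst₂ _<_ (sym (countᵇ≡card (λ z → lookup S x ∧ lookup S z ∧ adj G x z))) (card-adj x)
           (∑-mono-< ∧≤ y y-missing)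
    where
    ∧≤ : ∀ z → [ lookup S x ∧ lookup S z ∧ adj G x z ] ≤ [ adj G x z ]
    ∧≤ z with lookup S x | lookup S z
    ... | true | true = ≤-refl
    ... | true | false = z≤n
    ... | false | _ = z≤n
    y-missing : [ lookup S x ∧ lookup S y ∧ adj G x y ] < [ adj G x y ]
    y-missing rewrite Sx | Sy | xy = s≤s z≤n

  edgeBoundarySize≡cut : ∀ (S : Subset n) → edgeBoundarySize d G (induced G S) ≡ cut (lookup S)
  edgeBoundarySize≡cut S = trans (sum-map-allFin {n} _) (sum-cong-≗ (λ x → trans (countᵇ≡card {n} _) (sum-cong-≗ (λ y →
    boundary-indicator (lookup S x) _ (adj G x y) (lookup S y)
      (λ Sx xy Sy → Equivalence.to T-≡ (<⇒<ᵇ (subDegree<d S Sx xy Sy)))))))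

module SparseCuts {n d : ℕ} (G : Graph n) (regular : Regular d G) (3≤d : 3 ≤ d) (sparse : LocallySparse d G) where

  open Cuts G
  open DegreeCuts G regular

  d<cut : ∀ {f} → 3 ≤ card f → card f ≤ n ∸ 3 → d < cut f
  d<cut {f} 3≤|f| |f|≤n∸3 =
    subst (d <_) (trans (edgeBoundarySize≡cut S) (cut-cong {lookup S} {f} (lookup∘tabulate f)))
          (sparse (induced G S) (subst (3 ≤_) (sym |S|≡|f|) 3≤|f|) (subst (_≤ n ∸ 3) (sym |S|≡|f|) |f|≤n∸3))
    where
    S = Vec.tabulate f
    |S|≡|f| : ∣ S ∣ ≡ card f
    |S|≡|f| = trans (∣S∣≡card S) (card-cong (lookup∘tabulate f))

  Δ≤cut : ∀ {f} → 2 ≤ card f → card f ≤ n ∸ 3 → Δ d ≤ cut f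
  Δ≤cut {f} 2≤|f| |f|≤n∸3 with m≤n⇒m<n∨m≡n 2≤|f|
  ... | inj₁ 3≤|f| = d<cut⇒Δ≤cut {f} (d<cut 3≤|f| |f|≤n∸3)
  ... | inj₂ 2≡|f| = +-cancelʳ-≤ 2 (Δ d) (cut f) (≤-trans (Δ+2≤d+d 3≤d) (card≡2⇒d+d≤cut+2 (sym 2≡|f|)))

  d≤cut : ∀ {f} → 1 ≤ card f → card f ≤ n ∸ 3 → d ≤ cut f
  d≤cut {f} 1≤|f| |f|≤n∸3 with m≤n⇒m<n∨m≡n 1≤|f|
  ... | inj₁ 2≤|f| = ≤-trans (<⇒≤ (d<Δ d)) (Δ≤cut 2≤|f| |f|≤n∸3)
  ... | inj₂ 1≡|f| = card≡1⇒d≤cut (sym 1≡|f|)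

  record Closed (v : ℕ) (x y : Fin n) (f : VertexSet n) : Set where
    field
      closed : cut f ≡ Δ d
      size   : card f ≡ v
      edge   : adj G x y ≡ true
      x∈f    : f x ≡ true
      y∉f    : f y ≡ false
  open Closed

  Closed-∁ : ∀ {v x y f} → Closed v x y f → Closed (n ∸ v) y x (∁ f)
  Closed-∁ {v} {x} {y} {f} C = record
    { closed = trans (cut-∁ f) (closed C)
    ; size   = trans (sym (m+n∸n≡m (card (∁ f)) (card f))) (cong₂ _∸_ (card-∁ f) (size C))
    ; edge   = trans (Graph.sym G y x) (edge C)
    ; x∈f    = cong not (y∉f C)
    ; y∉f    = cong not (x∈f C)
    }

  module _ {v x y} {f g : VertexSet n} (v≤n∸3 : v ≤ n ∸ 3) (Cf : Closed v x y f) (Cg : Closed v x y g) (f≉g : ¬ f ≗ g) where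

    private
      χ = e[ f ∩ g , ∁ (f ∪ g) ]

      difference-cuts : cut (f ∖ g) + cut (g ∖ f) + 2 * χ ≡ Δ d + Δ d
      difference-cuts = trans (sym (cut-posimodular f g)) (cong₂ _+_ (closed Cf) (closed Cg))

      1≤χ : 1 ≤ χ
      1≤χ = edge⇒1≤e {f ∩ g} {∁ (f ∪ g)} (edge Cf)
              (cong₂ _∧_ (x∈f Cf) (x∈f Cg)) (cong not (cong₂ _∨_ (y∉f Cf) (y∉f Cg)))

      |f∖g|≡|g∖f| : card (f ∖ g) ≡ card (g ∖ f)
      |f∖g|≡|g∖f| = card-∖-comm {f = f} {g} (trans (size Cf) (sym (size Cg)))

      1≤|f∖g| : 1 ≤ card (f ∖ g)
      1≤|f∖g| = ≤∧≢⇒< z≤n (λ 0≡ → f≉g (∖-empty⇒≗ (sym 0≡) (trans (sym |f∖g|≡|g∖f|) (sym 0≡))))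

      |f∖g|≤n∸3 : card (f ∖ g) ≤ n ∸ 3
      |f∖g|≤n∸3 = ≤-trans (m≤n+m _ (card (f ∩ g)))
                    (≤-trans (≤-reflexive (trans (sym (card-∩-∖ f g)) (size Cf))) v≤n∸3)

      |g∖f|≤n∸3 : card (g ∖ f) ≤ n ∸ 3
      |g∖f|≤n∸3 = subst (_≤ n ∸ 3) |f∖g|≡|g∖f| |f∖g|≤n∸3

    crossing-bound : e[ f ∩ g , ∁ (f ∪ g) ] + d ≤ Δ d
    crossing-bound = *-cancelˡ-≤ 2 (begin
      2 * (χ + d)                           ≡⟨ solve 2 (λ x d → con 2 :* (x :+ d) := d :+ d :+ con 2 :* x) refl χ d ⟩
      d + d + 2 * χ                         ≤⟨ +-monoˡ-≤ (2 * χ) (+-mono-≤ (d≤cut 1≤|f∖g| |f∖g|≤n∸3)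
                                                 (d≤cut (subst (1 ≤_) |f∖g|≡|g∖f| 1≤|f∖g|) |g∖f|≤n∸3)) ⟩
      cut (f ∖ g) + cut (g ∖ f) + 2 * χ     ≡⟨ difference-cuts ⟩
      Δ d + Δ d                             ≡⟨ solve 1 (λ D → D :+ D := con 2 :* D) refl (Δ d) ⟩
      2 * Δ d                               ∎)
      where open ≤-Reasoning

    differ-by-one : card (f ∖ g) ≡ 1
    differ-by-one = ≤-antisym (≮⇒≥ too-far-apart) 1≤|f∖g|
      where
      too-far-apart : ¬ 2 ≤ card (f ∖ g)
      too-far-apart 2≤|f∖g| = m+1+n≰m (Δ d + Δ d) (begin
        Δ d + Δ d + 2                         ≤⟨ +-mono-≤ (+-mono-≤ (Δ≤cut 2≤|f∖g| |f∖g|≤n∸3)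
                                                   (Δ≤cut (subst (2 ≤_) |f∖g|≡|g∖f| 2≤|f∖g|) |g∖f|≤n∸3)) (*-monoʳ-≤ 2 1≤χ) ⟩
        cut (f ∖ g) + cut (g ∖ f) + 2 * χ     ≡⟨ difference-cuts ⟩
        Δ d + Δ d                             ∎)
        where open ≤-Reasoning

  no-sunflower : ∀ {v x y f₁ f₂ f₃} → 3 ≤ v → v ≤ n ∸ 3 →
    Closed v x y f₁ → Closed v x y f₂ → Closed v x y f₃ → ¬ f₁ ≗ f₂ → ¬ f₁ ≗ f₃ → ¬ f₂ ≗ f₃ →
    card (inExactlyTwo f₁ f₂ f₃) ≡ 0 → ⊥
  no-sunflower {v} {x} {y} {f₁} {f₂} {f₃} 3≤v v≤n∸3 C₁ C₂ C₃ f₁≉f₂ f₁≉f₃ f₂≉f₃ N₂≡0 =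
    <⇒≱ (Δ+Δ<d+d+d+2 3≤d) (+-cancelˡ-≤ (Δ d) _ _ (begin
      Δ d + (d + d + d + 2)             ≤⟨ +-monoˡ-≤ (d + d + d + 2) (Δ≤cut {A} 2≤|A| |A|≤n∸3) ⟩
      cut A + (d + d + d + 2)           ≡⟨ solve 2 (λ c d → c :+ (d :+ d :+ d :+ con 2) := d :+ d :+ d :+ (c :+ con 2)) refl (cut A) d ⟩
      d + d + d + (cut A + 2)           ≤⟨ +-monoʳ-≤ (d + d + d) (+-monoʳ-≤ (cut A) (*-monoʳ-≤ 2 1≤e[A,∁B])) ⟩
      d + d + d + (cut A + 2 * e[ A , ∁ B ])
                                        ≤⟨ +-monoʳ-≤ (d + d + d) (sunflower-crossings f₁ f₂ f₃ not-two) ⟩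
      d + d + d + (χ₁₂ + χ₁₃ + χ₂₃)     ≡⟨ solve 4 (λ d a b c → d :+ d :+ d :+ (a :+ b :+ c) :=
                                                               (a :+ d) :+ (b :+ d) :+ (c :+ d)) refl d χ₁₂ χ₁₃ χ₂₃ ⟩
      (χ₁₂ + d) + (χ₁₃ + d) + (χ₂₃ + d) ≤⟨ +-mono-≤ (+-mono-≤ (crossing-bound v≤n∸3 C₁ C₂ f₁≉f₂)
                                                             (crossing-bound v≤n∸3 C₁ C₃ f₁≉f₃))
                                                   (crossing-bound v≤n∸3 C₂ C₃ f₂≉f₃) ⟩
      Δ d + Δ d + Δ d                   ≡⟨ +-assoc (Δ d) (Δ d) (Δ d) ⟩
      Δ d + (Δ d + Δ d)                 ∎))
    where
    open ≤-Reasoning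
    A = f₁ ∩ f₂ ∩ f₃
    B = f₁ ∪ f₂ ∪ f₃
    χ₁₂ = e[ f₁ ∩ f₂ , ∁ (f₁ ∪ f₂) ]
    χ₁₃ = e[ f₁ ∩ f₃ , ∁ (f₁ ∪ f₃) ]
    χ₂₃ = e[ f₂ ∩ f₃ , ∁ (f₂ ∪ f₃) ]
    not-two : ∀ u → inExactlyTwo f₁ f₂ f₃ u ≡ false
    not-two u = [b]≡0⇒b≡false (∑≡0⇒≡0 _ N₂≡0 u)
    1+|A|≡v : suc (card A) ≡ v
    1+|A|≡v = begin-equality
      suc (card A)                       ≡⟨ +-comm 1 (card A) ⟩
      card A + 1                         ≡⟨ cong₂ _+_ (card-cong (λ u → ∧-absorbs-third (f₁ u) (f₂ u) (f₃ u) (not-two u)))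
                                                      (sym (differ-by-one v≤n∸3 C₁ C₂ f₁≉f₂)) ⟩
      card (f₁ ∩ f₂) + card (f₁ ∖ f₂)    ≡⟨ sym (card-∩-∖ f₁ f₂) ⟩
      card f₁                            ≡⟨ size C₁ ⟩
      v                                  ∎
    2≤|A| : 2 ≤ card A
    2≤|A| = s≤s⁻¹ (subst (3 ≤_) (sym 1+|A|≡v) 3≤v)
    |A|≤n∸3 : card A ≤ n ∸ 3
    |A|≤n∸3 = ≤-trans (n≤1+n _) (subst (_≤ n ∸ 3) (sym 1+|A|≡v) v≤n∸3)
    1≤e[A,∁B] : 1 ≤ e[ A , ∁ B ]
    1≤e[A,∁B] = edge⇒1≤e {A} {∁ B} (edge C₁)
      (cong₂ _∧_ (x∈f C₁) (cong₂ _∧_ (x∈f C₂) (x∈f C₃)))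
      (cong not (cong₂ _∨_ (y∉f C₁) (cong₂ _∨_ (y∉f C₂) (y∉f C₃))))

  -- Either the three sets share v - 1 vertices, or their complements do.
  no-three-closed : ∀ {v x y f₁ f₂ f₃} → 3 ≤ v → v ≤ n ∸ 3 →
    Closed v x y f₁ → Closed v x y f₂ → Closed v x y f₃ → ¬ f₁ ≗ f₂ → ¬ f₁ ≗ f₃ → ¬ f₂ ≗ f₃ → ⊥
  no-three-closed {v} {f₁ = f₁} {f₂} {f₃} 3≤v v≤n∸3 C₁ C₂ C₃ f₁≉f₂ f₁≉f₃ f₂≉f₃ =
    [ no-sunflower 3≤v v≤n∸3 C₁ C₂ C₃ f₁≉f₂ f₁≉f₃ f₂≉f₃
    , no-sunflower 3≤n∸v n∸v≤n∸3 (Closed-∁ C₁) (Closed-∁ C₂) (Closed-∁ C₃)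
                   (∁-≉ f₁≉f₂) (∁-≉ f₁≉f₃) (∁-≉ f₂≉f₃)
    ]′ (venn-dichotomy f₁ f₂ f₃ (size C₁) (size C₂) (size C₃)
         (one-apart C₁ C₂ f₁≉f₂) (one-apart C₁ C₃ f₁≉f₃) (one-apart C₂ C₃ f₂≉f₃))
    where
    one-apart : ∀ {x y f g} → Closed v x y f → Closed v x y g → ¬ f ≗ g → card (f ∖ g) + card (g ∖ f) ≡ 2
    one-apart Cf Cg f≉g = cong₂ _+_ (differ-by-one v≤n∸3 Cf Cg f≉g)
                                    (differ-by-one v≤n∸3 Cg Cf (λ g≗f → f≉g (sym ∘ g≗f)))
    ∁-≉ : ∀ {f g : VertexSet n} → ¬ f ≗ g → ¬ ∁ f ≗ ∁ g
    ∁-≉ f≉g ∁f≗∁g = f≉g (not-injective ∘ ∁f≗∁g)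
    3≤n∸v : 3 ≤ n ∸ v
    3≤n∸v = m+n≤o⇒m≤o∸n 3 (subst (_≤ n) (+-comm v 3)
              (m≤o∸n⇒m+n≤o v (≤-trans 3≤v (≤-trans v≤n∸3 (m∸n≤m n 3))) v≤n∸3))
    n∸v≤n∸3 : n ∸ v ≤ n ∸ 3
    n∸v≤n∸3 = ∸-monoʳ-≤ n 3≤v

  at-most-two-closed : ∀ {v x y} → 3 ≤ v → v ≤ n ∸ 3 → (Ss : List (Subset n)) → Unique Ss →
                       All (λ S → Closed v x y (lookup S)) Ss → length Ss ≤ 2
  at-most-two-closed _ _ [] _ _ = z≤n
  at-most-two-closed _ _ (_ ∷ []) _ _ = s≤s z≤n
  at-most-two-closed _ _ (_ ∷ _ ∷ []) _ _ = s≤s (s≤s z≤n)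
  at-most-two-closed 3≤v v≤n∸3 (S₁ ∷ S₂ ∷ S₃ ∷ _) ((S₁≢S₂ ∷ S₁≢S₃ ∷ _) ∷ (S₂≢S₃ ∷ _) ∷ _)
                     (C₁ ∷ C₂ ∷ C₃ ∷ _) =
    ⊥-elim (no-three-closed 3≤v v≤n∸3 C₁ C₂ C₃
              (S₁≢S₂ ∘ lookup-≗⇒≡) (S₁≢S₃ ∘ lookup-≗⇒≡) (S₂≢S₃ ∘ lookup-≗⇒≡))
    where
    lookup-≗⇒≡ : ∀ {S T : Subset n} → lookup S ≗ lookup T → S ≡ T
    lookup-≗⇒≡ {S} {T} S≗T = trans (sym (tabulate∘lookup S)) (trans (tabulate-cong S≗T) (tabulate∘lookup T))

allSubsets-unique : ∀ n → Unique (allSubsets n)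
allSubsets-unique zero = [] ∷ []
allSubsets-unique (suc n) =
  Unique.++⁺ (Unique.map⁺ ∷-injectiveʳ (allSubsets-unique n)) (Unique.map⁺ ∷-injectiveʳ (allSubsets-unique n)) disjoint
  where
  disjoint : ∀ {S} → ¬ (S ∈ map (true Vec.∷_) (allSubsets n) × S ∈ map (false Vec.∷_) (allSubsets n))
  disjoint (S∈true , S∈false) with ∈-map⁻ (true Vec.∷_) S∈true | ∈-map⁻ (false Vec.∷_) S∈false
  ... | _ , _ , refl | _ , _ , ()

prefix-size : ∀ {n} k → ∑[ u < n ] [ toℕ u <ᵇ k ] ≤ k
prefix-size {zero} k = z≤n
prefix-size {suc n} zero = ≤-reflexive (sum-replicate-zero n)
prefix-size {suc n} (suc k) = s≤s (prefix-size {n} k)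

sum-map-const : ∀ {A : Set} {h : A → ℕ} {c} {xs} → All (λ x → h x ≡ c) xs → sum (map h xs) ≡ length xs * c
sum-map-const [] = refl
sum-map-const (hx≡c ∷ hxs≡c) = cong₂ _+_ hx≡c (sum-map-const hxs≡c)

module ClosedCount {n d : ℕ} (G : Graph n) (regular : Regular d G) (3≤d : 3 ≤ d) (sparse : LocallySparse d G)
                   (k v : ℕ) (3≤v : 3 ≤ v) (v≤n∸3 : v ≤ n ∸ 3) where

  open Cuts G
  open DegreeCuts G regular
  open SparseCuts G regular 3≤d sparse

  counted : Subset n → Bool
  counted S = isClosed d G S ∧ inPrefix k S ∧ (∣ S ∣ ≡ᵇ v)

  closedSets : List (Subset n)
  closedSets = filterᵇ counted (allSubsets n)

  exits : Fin n → Fin n → Subset n → Bool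
  exits u w S = lookup S u ∧ not (lookup S w)

  multiplicity : Fin n → Fin n → ℕ
  multiplicity u w = length (filterᵇ (exits u w) closedSets)

  counted⁻ : ∀ S → T (counted S) → cut (lookup S) ≡ Δ d × T (inPrefix k S) × card (lookup S) ≡ v
  counted⁻ S c with Equivalence.to (T-∧ {isClosed d G S}) c
  ... | closed , rest with Equivalence.to (T-∧ {inPrefix k S}) rest
  ... | prefix , size = trans (sym (edgeBoundarySize≡cut S)) (≡ᵇ⇒≡ _ _ closed)
                      , prefix
                      , trans (sym (∣S∣≡card S)) (≡ᵇ⇒≡ _ _ size)

  exits⁻ : ∀ {u w} S → T (exits u w S) → lookup S u ≡ true × lookup S w ≡ false
  exits⁻ {u} S e with Equivalence.to (T-∧ {lookup S u}) e
  ... | Su , ¬Sw = Equivalence.to T-≡ Su , Equivalence.to T-not-≡ ¬Sw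

  inPrefix⁻ : ∀ {S u} → T (inPrefix k S) → lookup S u ≡ true → T (toℕ u <ᵇ k)
  inPrefix⁻ {S} {u} prefix Su = subst (λ b → T (not b ∨ (toℕ u <ᵇ k))) Su
    (All.lookup (all⁺ (λ x → not (lookup S x) ∨ (toℕ x <ᵇ k)) (allFin n) prefix) (∈-allFin u))

  closedSets-counted : All (T ∘ counted) closedSets
  closedSets-counted = all-filter (T? ∘ counted) (allSubsets n)

  Δ*count≡edgeSum-multiplicity : Δ d * length closedSets ≡ edgeSum multiplicity
  Δ*count≡edgeSum-multiplicity = begin
    Δ d * length closedSets
      ≡⟨ *-comm (Δ d) _ ⟩
    length closedSets * Δ d
      ≡⟨ sym (sum-map-const (All.map (λ {S} c → proj₁ (counted⁻ S c)) closedSets-counted)) ⟩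
    sum (map (λ S → edgeSum (λ u w → [ exits u w S ])) closedSets)
      ≡⟨ sum-map-edgeSum (λ S u w → [ exits u w S ]) closedSets ⟩
    edgeSum (λ u w → sum (map (λ S → [ exits u w S ]) closedSets))
      ≡⟨ edgeSum-cong (λ u w → sym (length-filterᵇ (exits u w) closedSets)) ⟩
    edgeSum multiplicity ∎
    where open ≡-Reasoning

  multiplicity≤ : ∀ u w → adj G u w ≡ true → multiplicity u w ≤ 2 * [ toℕ u <ᵇ k ]
  multiplicity≤ u w uw with toℕ u <ᵇ k in u<k
  ... | true = at-most-two-closed 3≤v v≤n∸3 (filterᵇ (exits u w) closedSets)
                 (Unique.filter⁺ (T? ∘ exits u w) (Unique.filter⁺ (T? ∘ counted) (allSubsets-unique n)))
                 (All.zipWith (λ {S} → to-closed S)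
                   (filter⁺ (T? ∘ exits u w) closedSets-counted , all-filter (T? ∘ exits u w) closedSets))
    where
    to-closed : ∀ S → T (counted S) × T (exits u w S) → Closed v u w (lookup S)
    to-closed S (c , e) = record
      { closed = proj₁ (counted⁻ S c)
      ; size   = proj₂ (proj₂ (counted⁻ S c))
      ; edge   = uw
      ; x∈f    = proj₁ (exits⁻ S e)
      ; y∉f    = proj₂ (exits⁻ S e)
      }
  ... | false = ≤-reflexive (cong length (filter-none (T? ∘ exits u w) (All.map (λ {S} → never-exits S) closedSets-counted)))
    where
    never-exits : ∀ S → T (counted S) → ¬ T (exits u w S)
    never-exits S c e = subst T u<k (inPrefix⁻ {S} (proj₁ (proj₂ (counted⁻ S c))) (proj₁ (exits⁻ S e)))

claim3 : ∀ {n : ℕ} (d : ℕ) (F : Graph n) (k v : ℕ) →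
         3 ≤ d → Regular d F → LocallySparse d F →
         3 ≤ v → v ≤ n ∸ 3 →
         3 * closedCount d F k v ≤ 2 * d * k
claim3 {n} d F k v 3≤d regular sparse 3≤v v≤n∸3 = begin
  3 * length closedSets                          ≤⟨ *-monoˡ-≤ _ (≤-trans 3≤d (<⇒≤ (d<Δ d))) ⟩
  Δ d * length closedSets                        ≡⟨ Δ*count≡edgeSum-multiplicity ⟩
  edgeSum multiplicity                           ≤⟨ edgeSum-mono multiplicity≤ ⟩
  edgeSum (λ u w → 2 * [ toℕ u <ᵇ k ])           ≡⟨ edgeSum-source _ ⟩
  d * ∑[ u < n ] (2 * [ toℕ u <ᵇ k ])            ≡⟨ cong (d *_) (sym (*-distribˡ-sum {n} 2 _)) ⟩
  d * (2 * ∑[ u < n ] [ toℕ u <ᵇ k ])            ≤⟨ *-monoʳ-≤ d (*-monoʳ-≤ 2 (prefix-size {n} k)) ⟩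
  d * (2 * k)                                    ≡⟨ solve 2 (λ d k → d :* (con 2 :* k) := con 2 :* d :* k) refl d k ⟩
  2 * d * k                                      ∎
  where
  open ≤-Reasoning
  open Cuts F
  open DegreeCuts F regular
  open ClosedCount F regular 3≤d sparse k v 3≤v v≤n∸3
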